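{- Let $(c_n)_{n\ge0}$ be determined by $c_0=1$ and $\sum_{k=0}^{N}\frac{c_k}{N+k+1}=0$ for $N\ge1$. Set $a_n=c_{n-1}$ for $n\ge1$, $g(t)=2/(1+t)$ and $A_g(x)=\sum_{n\le x}a_n\,g(n/x)$ for real $x\ge1$. If $a_n=O(n^{ -3/2})$, then $A_g(x)=O(x^{ -3/2})$ as $x\to\infty$.
   Context: The bound $a_n=O(n^{ -3/2})$ is a known result of Kalmynin and Kosenko for this sequence.
   Formalization: The variable x in $A_g(x)$ ranges over the rationals x ≥ 1 rather than over all real x ≥ 1. -}

module Defs where

open import Data.Nat as ℕ using (ℕ; zero; suc)
open import Data.Integer as ℤ using (ℤ; +_)
open import Data.Rational
open import Data.Rational.Properties

ℕ→ℚ : ℕ → ℚ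
ℕ→ℚ n = + n / 1

Σ0to : ℕ → (ℕ → ℚ) → ℚ
Σ0to zero    f = f 0
Σ0to (suc N) f = Σ0to N f + f (suc N)

Σ1to : ℕ → (ℕ → ℚ) → ℚ
Σ1to zero    f = 0ℚ
Σ1to (suc M) f = Σ1to M f + f (suc M)

g : (t : ℚ) → .{{NonNegative t}} → ℚ
g t = (ℕ→ℚ 2 ÷ (1ℚ + t)) {{pos⇒nonZero (1ℚ + t) {{pos+nonNeg⇒pos 1ℚ t}}}}

≥1⇒pos : (x : ℚ) → 1ℚ ≤ x → Positive x
≥1⇒pos x 1≤x = positive (<-≤-trans (positive⁻¹ 1ℚ) 1≤x)

divBy : (n : ℕ) (x : ℚ) → 1ℚ ≤ x → ℚ
divBy n x 1≤x = (ℕ→ℚ n ÷ x) {{pos⇒nonZero x {{≥1⇒pos x 1≤x}}}}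

divBy-nonNeg : (n : ℕ) (x : ℚ) (1≤x : 1ℚ ≤ x) → NonNegative (divBy n x 1≤x)
divBy-nonNeg n x 1≤x =
  nonNeg*nonNeg⇒nonNeg (ℕ→ℚ n) {{normalize-nonNeg n 1}}
    ((1/ x) {{pos⇒nonZero x {{px}}}})
    {{pos⇒nonNeg ((1/ x) {{pos⇒nonZero x {{px}}}}) {{1/pos⇒pos x {{px}}}}}}
  where px = ≥1⇒pos x 1≤x

A-g : (a : ℕ → ℚ) (x : ℚ) → 1ℚ ≤ x → ℚ
A-g a x 1≤x =
  Σ1to ℤ.∣ floor x ∣ (λ n → a n * g (divBy n x 1≤x) {{divBy-nonNeg n x 1≤x}})

{-# OPTIONS --safe #-}
-- Write ⌊x⌋ = M = N + 1 and x = M + y with 0 ≤ y < 1. The partial fraction identity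
--   1/(x+n) = - y/(N+n) + (1+y)/(M+n) + y(1+y)/((N+n)(M+n)(x+n))
-- splits A_g(x) = Σ_{n ≤ M} a_n 2x/(x+n) into three sums. Against a_n = c_{n-1} the first
-- vanishes by the recurrence at N and the second is -c_M/(2M+1) by the recurrence at M,
-- so A_g(x) = 2x(1+y)(S₁ + y S₂) with S₁ = -c_M/(2M+1), S₂ = Σ_{n ≤ M} a_n/((N+n)(M+n)(x+n)).
-- The hypothesis a_n² n³ ≤ K bounds x⁵ S₁² directly, and Cauchy–Schwarz gives
-- x⁶ S₂² ≤ 4M Σ a_n² ≤ 8KM, since Σ a_n² ≤ K Σ n⁻³ ≤ 2K by telescoping against 2/n - 2/(n+1).
-- There are no square roots in ℚ, so O(x^(-3/2)) is carried as a bound on A_g(x)² x³.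

module Submission where

open import Defs
open import Data.Nat as ℕ using (ℕ; zero; suc; _∸_; z≤n; s≤s)
import Data.Nat.Properties as ℕₚ
open import Data.Nat.Coprimality using (1-coprimeTo) renaming (sym to coprime-sym)
open import Data.Integer as ℤ using (+_; -[1+_])
import Data.Integer.Properties as ℤₚ
open import Data.Integer.DivMod using ([n/ℕd]*d≤n; n<s[n/ℕd]*d; div-pos-is-/ℕ)
open import Data.Rational
open import Data.Rational.Properties
import Data.Rational.Unnormalised as ℚᵘ
import Data.Rational.Unnormalised.Properties as ℚᵘₚ
open import Algebra.Properties.Group +-0-group using (inverseˡ-unique)
open import Data.Product using (∃; _×_; _,_; proj₁; proj₂)
open import Data.Sum using (inj₁; inj₂)
open import Data.Empty using (⊥-elim)
open import Level using (0ℓ)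
open import Relation.Binary.PropositionalEquality
open import Relation.Nullary.Decidable using (dec⇒maybe)
open import Tactic.RingSolver using (solve-∀)
open import Data.Integer.Tactic.RingSolver using () renaming (solve-∀ to ℤ-solve-∀)
open import Tactic.RingSolver.Core.AlmostCommutativeRing using (AlmostCommutativeRing; fromCommutativeRing)

ℚ-ring : AlmostCommutativeRing 0ℓ 0ℓ
ℚ-ring = fromCommutativeRing +-*-commutativeRing (λ p → dec⇒maybe (0ℚ ≟ p))

*-nonNeg : ∀ {p q} → 0ℚ ≤ p → 0ℚ ≤ q → 0ℚ ≤ p * q
*-nonNeg {p} {q} 0≤p 0≤q =
  nonNegative⁻¹ (p * q) {{nonNeg*nonNeg⇒nonNeg p {{nonNegative 0≤p}} q {{nonNegative 0≤q}}}}

*-mono-≤-nonNeg : ∀ {p q r s} → 0ℚ ≤ p → 0ℚ ≤ r → p ≤ q → r ≤ s → p * r ≤ q * s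
*-mono-≤-nonNeg {p} {q} {r} {s} 0≤p 0≤r p≤q r≤s =
  ≤-trans (*-monoʳ-≤-nonNeg r {{nonNegative 0≤r}} p≤q)
          (*-monoˡ-≤-nonNeg q {{nonNegative (≤-trans 0≤p p≤q)}} r≤s)

square-mono-≤ : ∀ {p q} → 0ℚ ≤ p → p ≤ q → p * p ≤ q * q
square-mono-≤ 0≤p p≤q = *-mono-≤-nonNeg 0≤p 0≤p p≤q p≤q

cube-mono-≤ : ∀ {p q} → 0ℚ ≤ p → p ≤ q → p * p * p ≤ q * q * q
cube-mono-≤ 0≤p p≤q = *-mono-≤-nonNeg (*-nonNeg 0≤p 0≤p) 0≤p (square-mono-≤ 0≤p p≤q) p≤q

∣p∣*∣p∣≡p*p : ∀ p → ∣ p ∣ * ∣ p ∣ ≡ p * p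
∣p∣*∣p∣≡p*p p with ∣p∣≡p∨∣p∣≡-p p
... | inj₁ ∣p∣≡p  = cong₂ _*_ ∣p∣≡p ∣p∣≡p
... | inj₂ ∣p∣≡-p = trans (cong₂ _*_ ∣p∣≡-p ∣p∣≡-p) (-p*-p≡p*p p)
  where
  -p*-p≡p*p : ∀ p → - p * - p ≡ p * p
  -p*-p≡p*p = solve-∀ ℚ-ring

square-nonNeg : ∀ p → 0ℚ ≤ p * p
square-nonNeg p = subst (0ℚ ≤_) (∣p∣*∣p∣≡p*p p) (*-nonNeg (0≤∣p∣ p) (0≤∣p∣ p))

p≤q⇒0≤q-p : ∀ {p q} → p ≤ q → 0ℚ ≤ q - p
p≤q⇒0≤q-p {p} {q} p≤q = subst (_≤ q - p) (+-inverseʳ p) (+-monoˡ-≤ (- p) p≤q)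

0≤q-p⇒p≤q : ∀ {p q} → 0ℚ ≤ q - p → p ≤ q
0≤q-p⇒p≤q {p} {q} 0≤q-p = subst₂ _≤_ (+-identityʳ p) (p+[q-p]≡q p q) (+-monoʳ-≤ p 0≤q-p)
  where
  p+[q-p]≡q : ∀ p q → p + (q - p) ≡ q
  p+[q-p]≡q = solve-∀ ℚ-ring

[p+q]²≤2p²+2q² : ∀ p q → (p + q) * (p + q) ≤ ℕ→ℚ 2 * (p * p) + ℕ→ℚ 2 * (q * q)
[p+q]²≤2p²+2q² p q = 0≤q-p⇒p≤q (subst (0ℚ ≤_) (difference p q) (square-nonNeg (p - q)))
  where
  difference : ∀ p q → (p - q) * (p - q) ≡ ℕ→ℚ 2 * (p * p) + ℕ→ℚ 2 * (q * q) - (p + q) * (p + q)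
  difference = solve-∀ ℚ-ring

eventually-bounded⇒bounded : ∀ (f : ℕ → ℚ) n₀ {C} → (∀ n → n₀ ℕ.≤ n → f n ≤ C) →
  ∃ λ K → ∀ n → f n ≤ K
eventually-bounded⇒bounded f zero     {C} bound = C , λ n → bound n z≤n
eventually-bounded⇒bounded f (suc n₀) {C} bound = eventually-bounded⇒bounded f n₀ bound′
  where
  bound′ : ∀ n → n₀ ℕ.≤ n → f n ≤ C ⊔ f n₀
  bound′ n n₀≤n with ℕₚ.m≤n⇒m<n∨m≡n n₀≤n
  ... | inj₁ n₀<n = p≤q⇒p≤q⊔r (f n₀) (bound n n₀<n)
  ... | inj₂ refl = p≤q⊔p C (f n₀)

ℕ→ℚ≡mkℚ : ∀ n → ℕ→ℚ n ≡ mkℚ (+ n) 0 (coprime-sym (1-coprimeTo n))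
ℕ→ℚ≡mkℚ n = normalize-coprime (coprime-sym (1-coprimeTo n))

ℕ→ℚ-suc : ∀ n → ℕ→ℚ (suc n) ≡ ℕ→ℚ n + 1ℚ
ℕ→ℚ-suc n = toℚᵘ-injective (begin
  toℚᵘ (ℕ→ℚ (suc n))               ≡⟨ cong toℚᵘ (ℕ→ℚ≡mkℚ (suc n)) ⟩
  ℚᵘ.mkℚᵘ (+ suc n) 0               ≈⟨ ℚᵘ.*≡* (cross-multiplied (+ n)) ⟩
  ℚᵘ.mkℚᵘ (+ n) 0 ℚᵘ.+ toℚᵘ 1ℚ      ≡⟨ cong (ℚᵘ._+ toℚᵘ 1ℚ) (cong toℚᵘ (ℕ→ℚ≡mkℚ n)) ⟨
  toℚᵘ (ℕ→ℚ n) ℚᵘ.+ toℚᵘ 1ℚ         ≈⟨ toℚᵘ-homo-+ (ℕ→ℚ n) 1ℚ ⟨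
  toℚᵘ (ℕ→ℚ n + 1ℚ)                 ∎)
  where
  open ℚᵘₚ.≃-Reasoning
  cross-multiplied : ∀ m → (+ 1 ℤ.+ m) ℤ.* + 1 ≡ (m ℤ.* + 1 ℤ.+ + 1 ℤ.* + 1) ℤ.* + 1
  cross-multiplied = ℤ-solve-∀

ℕ→ℚ-+ : ∀ m n → ℕ→ℚ (m ℕ.+ n) ≡ ℕ→ℚ m + ℕ→ℚ n
ℕ→ℚ-+ zero    n = sym (+-identityˡ (ℕ→ℚ n))
ℕ→ℚ-+ (suc m) n = begin
  ℕ→ℚ (suc (m ℕ.+ n))          ≡⟨ ℕ→ℚ-suc (m ℕ.+ n) ⟩
  ℕ→ℚ (m ℕ.+ n) + 1ℚ           ≡⟨ cong (_+ 1ℚ) (ℕ→ℚ-+ m n) ⟩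
  ℕ→ℚ m + ℕ→ℚ n + 1ℚ           ≡⟨ rearrange (ℕ→ℚ m) (ℕ→ℚ n) ⟩
  ℕ→ℚ m + 1ℚ + ℕ→ℚ n           ≡⟨ cong (_+ ℕ→ℚ n) (ℕ→ℚ-suc m) ⟨
  ℕ→ℚ (suc m) + ℕ→ℚ n          ∎
  where
  open ≡-Reasoning
  rearrange : ∀ p q → p + q + 1ℚ ≡ p + 1ℚ + q
  rearrange = solve-∀ ℚ-ring

ℕ→ℚ-nonNeg : ∀ n → 0ℚ ≤ ℕ→ℚ n
ℕ→ℚ-nonNeg n = nonNegative⁻¹ (ℕ→ℚ n) {{normalize-nonNeg n 1}}

ℕ→ℚ-pos : ∀ n → 0ℚ < ℕ→ℚ (suc n)
ℕ→ℚ-pos n = positive⁻¹ (ℕ→ℚ (suc n)) {{normalize-pos (suc n) 1}}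

ℕ→ℚ-mono-≤ : ∀ {m n} → m ℕ.≤ n → ℕ→ℚ m ≤ ℕ→ℚ n
ℕ→ℚ-mono-≤ {m} m≤n with ℕₚ.m≤n⇒∃[o]m+o≡n m≤n
... | o , refl = subst₂ _≤_ (+-identityʳ (ℕ→ℚ m)) (sym (ℕ→ℚ-+ m o)) (+-monoʳ-≤ (ℕ→ℚ m) (ℕ→ℚ-nonNeg o))

x≤x+n : ∀ x n → x ≤ x + ℕ→ℚ n
x≤x+n x n = subst (_≤ x + ℕ→ℚ n) (+-identityʳ x) (+-monoʳ-≤ x (ℕ→ℚ-nonNeg n))

recip : (p : ℚ) → .(0ℚ < p) → ℚ
recip p p>0 = (1/ p) {{pos⇒nonZero p {{positive p>0}}}}

recip-inverseˡ : ∀ p .(p>0 : 0ℚ < p) → recip p p>0 * p ≡ 1ℚ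
recip-inverseˡ p p>0 = *-inverseˡ p {{pos⇒nonZero p {{positive p>0}}}}

recip-nonNeg : ∀ p .(p>0 : 0ℚ < p) → 0ℚ ≤ recip p p>0
recip-nonNeg p p>0 =
  <⇒≤ (positive⁻¹ (recip p p>0) {{1/pos⇒pos p {{positive p>0}}}})

1/suc-inverseˡ : ∀ j → (+ 1 / suc j) * ℕ→ℚ (suc j) ≡ 1ℚ
1/suc-inverseˡ j = trans
  (cong₂ _*_ (normalize-coprime (1-coprimeTo (suc j))) (ℕ→ℚ≡mkℚ (suc j)))
  (*-inverseˡ (mkℚ (+ suc j) 0 (coprime-sym (1-coprimeTo (suc j)))))

1/suc-nonNeg : ∀ j → 0ℚ ≤ + 1 / suc j
1/suc-nonNeg j = nonNegative⁻¹ (+ 1 / suc j) {{normalize-nonNeg 1 (suc j)}}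

*-inverse-unique : ∀ {p q} .{{_ : NonZero q}} → p * q ≡ 1ℚ → p ≡ 1/ q
*-inverse-unique {p} {q} pq≡1 = begin
  p              ≡⟨ *-identityʳ p ⟨
  p * 1ℚ         ≡⟨ cong (p *_) (*-inverseʳ q) ⟨
  p * (q * 1/ q) ≡⟨ *-assoc p q (1/ q) ⟨
  p * q * 1/ q   ≡⟨ cong (_* 1/ q) pq≡1 ⟩
  1ℚ * 1/ q      ≡⟨ *-identityˡ (1/ q) ⟩
  1/ q           ∎
  where open ≡-Reasoning

p≤aq⇒pr≤a : ∀ {p q r a} → 0ℚ ≤ r → r * q ≡ 1ℚ → p ≤ a * q → p * r ≤ a
p≤aq⇒pr≤a {p} {q} {r} {a} 0≤r rq≡1 p≤aq = begin
  p * r        ≤⟨ *-monoʳ-≤-nonNeg r {{nonNegative 0≤r}} p≤aq ⟩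
  a * q * r    ≡⟨ *-assoc a q r ⟩
  a * (q * r)  ≡⟨ cong (a *_) (trans (*-comm q r) rq≡1) ⟩
  a * 1ℚ       ≡⟨ *-identityʳ a ⟩
  a            ∎
  where open ≤-Reasoning

p≤q⇒pr≤1 : ∀ {p q r} → 0ℚ ≤ r → r * q ≡ 1ℚ → p ≤ q → p * r ≤ 1ℚ
p≤q⇒pr≤1 {p} {q} 0≤r rq≡1 p≤q = p≤aq⇒pr≤a 0≤r rq≡1 (subst (p ≤_) (sym (*-identityˡ q)) p≤q)

floor-bounds : ∀ x → 0ℚ ≤ x → ℕ→ℚ ℤ.∣ floor x ∣ ≤ x × x < ℕ→ℚ (suc ℤ.∣ floor x ∣)
floor-bounds (mkℚ -[1+ n ] d _) (*≤* ())
floor-bounds x@(mkℚ (+ n) d _) _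
  rewrite div-pos-is-/ℕ (+ n) (suc d) {{_}} | ℕ→ℚ≡mkℚ (n ℕ./ suc d) | ℕ→ℚ≡mkℚ (suc (n ℕ./ suc d)) =
    *≤* (subst (+ (n ℕ./ suc d) ℤ.* + suc d ℤ.≤_) (sym (ℤₚ.*-identityʳ (+ n))) ([n/ℕd]*d≤n (+ n) (suc d))) ,
    *<* (subst (ℤ._< + suc (n ℕ./ suc d) ℤ.* + suc d) (sym (ℤₚ.*-identityʳ (+ n))) (n<s[n/ℕd]*d (+ n) (suc d)))

-- Finite sums

Σ0to-cong : ∀ N {f h : ℕ → ℚ} → (∀ k → f k ≡ h k) → Σ0to N f ≡ Σ0to N h
Σ0to-cong zero    f≡h = f≡h 0
Σ0to-cong (suc N) f≡h = cong₂ _+_ (Σ0to-cong N f≡h) (f≡h (suc N))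

*-distribˡ-Σ0to : ∀ N r f → r * Σ0to N f ≡ Σ0to N (λ k → r * f k)
*-distribˡ-Σ0to zero    r f = refl
*-distribˡ-Σ0to (suc N) r f =
  trans (*-distribˡ-+ r (Σ0to N f) (f (suc N))) (cong (_+ r * f (suc N)) (*-distribˡ-Σ0to N r f))

Σ0to-linear₃ : ∀ N α β γ f g h →
  Σ0to N (λ k → α * f k + β * g k + γ * h k) ≡ α * Σ0to N f + β * Σ0to N g + γ * Σ0to N h
Σ0to-linear₃ zero    α β γ f g h = refl
Σ0to-linear₃ (suc N) α β γ f g h =
  trans (cong (_+ (α * f (suc N) + β * g (suc N) + γ * h (suc N))) (Σ0to-linear₃ N α β γ f g h))
        (regroup α β γ (Σ0to N f) (Σ0to N g) (Σ0to N h) (f (suc N)) (g (suc N)) (h (suc N)))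
  where
  regroup : ∀ α β γ F G H a b c →
    α * F + β * G + γ * H + (α * a + β * b + γ * c) ≡ α * (F + a) + β * (G + b) + γ * (H + c)
  regroup = solve-∀ ℚ-ring

Σ1to-suc : ∀ N f → Σ1to (suc N) f ≡ Σ0to N (λ k → f (suc k))
Σ1to-suc zero    f = +-identityˡ (f 1)
Σ1to-suc (suc N) f = cong (_+ f (suc (suc N))) (Σ1to-suc N f)

Σ0to-telescope-≤ : ∀ (b T : ℕ → ℚ) → (∀ k → b k + T (suc k) ≤ T k) →
  ∀ N → Σ0to N b + T (suc N) ≤ T 0
Σ0to-telescope-≤ b T step zero    = step 0
Σ0to-telescope-≤ b T step (suc N) = begin
  Σ0to N b + b (suc N) + T (suc (suc N))    ≡⟨ +-assoc (Σ0to N b) (b (suc N)) _ ⟩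
  Σ0to N b + (b (suc N) + T (suc (suc N)))  ≤⟨ +-monoʳ-≤ (Σ0to N b) (step (suc N)) ⟩
  Σ0to N b + T (suc N)                      ≤⟨ Σ0to-telescope-≤ b T step N ⟩
  T 0                                       ∎
  where open ≤-Reasoning

cauchy-schwarz-step : ∀ {μ s q} a → 0ℚ < μ → s * s ≤ μ * q →
  (s + a) * (s + a) ≤ (μ + 1ℚ) * (q + a * a)
cauchy-schwarz-step {μ} {s} {q} a μ>0 s²≤μq =
  0≤q-p⇒p≤q (*-cancelˡ-≤-pos μ {{positive μ>0}} (begin
    μ * 0ℚ                                                   ≡⟨ *-zeroʳ μ ⟩
    0ℚ                                                       ≤⟨ +-mono-≤ (*-nonNeg μ+1≥0 (p≤q⇒0≤q-p s²≤μq))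
                                                                          (square-nonNeg (s - μ * a)) ⟩
    (μ + 1ℚ) * (μ * q - s * s) + (s - μ * a) * (s - μ * a)   ≡⟨ lagrange μ s q a ⟩
    μ * ((μ + 1ℚ) * (q + a * a) - (s + a) * (s + a))         ∎))
  where
  open ≤-Reasoning
  μ+1≥0 : 0ℚ ≤ μ + 1ℚ
  μ+1≥0 = <⇒≤ (positive⁻¹ (μ + 1ℚ) {{pos+pos⇒pos μ {{positive μ>0}} 1ℚ}})
  lagrange : ∀ μ s q a → (μ + 1ℚ) * (μ * q - s * s) + (s - μ * a) * (s - μ * a)
                       ≡ μ * ((μ + 1ℚ) * (q + a * a) - (s + a) * (s + a))
  lagrange = solve-∀ ℚ-ring

Σ0to-cauchy-schwarz : ∀ N t → Σ0to N t * Σ0to N t ≤ ℕ→ℚ (suc N) * Σ0to N (λ k → t k * t k)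
Σ0to-cauchy-schwarz zero    t = ≤-reflexive (sym (*-identityˡ (t 0 * t 0)))
Σ0to-cauchy-schwarz (suc N) t =
  subst (λ m → Σ0to (suc N) t * Σ0to (suc N) t ≤ m * Σ0to (suc N) (λ k → t k * t k))
        (sym (ℕ→ℚ-suc (suc N)))
        (cauchy-schwarz-step {s = Σ0to N t} (t (suc N)) (ℕ→ℚ-pos N) (Σ0to-cauchy-schwarz N t))

b*m³≤K⇒b*m[m+1]≤2K : ∀ {b K m} → 0ℚ ≤ b → 1ℚ ≤ m → b * (m * m * m) ≤ K →
  b * (m * (m + 1ℚ)) ≤ ℕ→ℚ 2 * K
b*m³≤K⇒b*m[m+1]≤2K {b} {K} {m} 0≤b 1≤m bm³≤K =
  0≤q-p⇒p≤q (subst (0ℚ ≤_) (slack b K m)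
    (+-mono-≤ (*-nonNeg (ℕ→ℚ-nonNeg 2) (p≤q⇒0≤q-p bm³≤K))
              (*-nonNeg (*-nonNeg 0≤b 0≤m) (*-nonNeg 0≤2m+1 (p≤q⇒0≤q-p 1≤m)))))
  where
  0≤m : 0ℚ ≤ m
  0≤m = ≤-trans (ℕ→ℚ-nonNeg 1) 1≤m
  0≤2m+1 : 0ℚ ≤ ℕ→ℚ 2 * m + 1ℚ
  0≤2m+1 = +-mono-≤ (*-nonNeg (ℕ→ℚ-nonNeg 2) 0≤m) (ℕ→ℚ-nonNeg 1)
  slack : ∀ b K m → ℕ→ℚ 2 * (K - b * (m * m * m)) + b * m * ((ℕ→ℚ 2 * m + 1ℚ) * (m - 1ℚ))
                  ≡ ℕ→ℚ 2 * K - b * (m * (m + 1ℚ))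
  slack = solve-∀ ℚ-ring

b*m³≤K⇒b+2Kq≤2Kp : ∀ {b K m p q} → 0ℚ ≤ b → 1ℚ ≤ m → b * (m * m * m) ≤ K →
  p * m ≡ 1ℚ → q * (m + 1ℚ) ≡ 1ℚ → b + ℕ→ℚ 2 * K * q ≤ ℕ→ℚ 2 * K * p
b*m³≤K⇒b+2Kq≤2Kp {b} {K} {m} {p} {q} 0≤b 1≤m bm³≤K pm≡1 q[m+1]≡1 =
  *-cancelˡ-≤-pos (m * (m + 1ℚ)) {{m[m+1]-pos}} (begin
    m * (m + 1ℚ) * (b + ℕ→ℚ 2 * K * q)
      ≡⟨ expandˡ b K m q ⟩
    b * (m * (m + 1ℚ)) + ℕ→ℚ 2 * K * m * (q * (m + 1ℚ))
      ≡⟨ cong (λ z → b * (m * (m + 1ℚ)) + ℕ→ℚ 2 * K * m * z) q[m+1]≡1 ⟩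
    b * (m * (m + 1ℚ)) + ℕ→ℚ 2 * K * m * 1ℚ
      ≤⟨ +-monoˡ-≤ _ (b*m³≤K⇒b*m[m+1]≤2K 0≤b 1≤m bm³≤K) ⟩
    ℕ→ℚ 2 * K + ℕ→ℚ 2 * K * m * 1ℚ
      ≡⟨ expandʳ K m ⟨
    ℕ→ℚ 2 * K * (m + 1ℚ) * 1ℚ
      ≡⟨ cong (ℕ→ℚ 2 * K * (m + 1ℚ) *_) pm≡1 ⟨
    ℕ→ℚ 2 * K * (m + 1ℚ) * (p * m)
      ≡⟨ regroup K m p ⟩
    m * (m + 1ℚ) * (ℕ→ℚ 2 * K * p) ∎)
  where
  open ≤-Reasoning
  m-pos : Positive m
  m-pos = positive (<-≤-trans (ℕ→ℚ-pos 0) 1≤m)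
  m[m+1]-pos : Positive (m * (m + 1ℚ))
  m[m+1]-pos = pos*pos⇒pos m {{m-pos}} (m + 1ℚ) {{pos+pos⇒pos m {{m-pos}} 1ℚ}}
  expandˡ : ∀ b K m q → m * (m + 1ℚ) * (b + ℕ→ℚ 2 * K * q)
                      ≡ b * (m * (m + 1ℚ)) + ℕ→ℚ 2 * K * m * (q * (m + 1ℚ))
  expandˡ = solve-∀ ℚ-ring
  expandʳ : ∀ K m → ℕ→ℚ 2 * K * (m + 1ℚ) * 1ℚ ≡ ℕ→ℚ 2 * K + ℕ→ℚ 2 * K * m * 1ℚ
  expandʳ = solve-∀ ℚ-ring
  regroup : ∀ K m p → ℕ→ℚ 2 * K * (m + 1ℚ) * (p * m) ≡ m * (m + 1ℚ) * (ℕ→ℚ 2 * K * p)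
  regroup = solve-∀ ℚ-ring

InverseCubeBound : (ℕ → ℚ) → ℚ → Set
InverseCubeBound b K = ∀ k → b k * (ℕ→ℚ (suc k) * ℕ→ℚ (suc k) * ℕ→ℚ (suc k)) ≤ K

Σ0to-inverse-cube-≤ : ∀ {K} (b : ℕ → ℚ) → (∀ k → 0ℚ ≤ b k) → InverseCubeBound b K →
  ∀ N → Σ0to N b ≤ ℕ→ℚ 2 * K
Σ0to-inverse-cube-≤ {K} b 0≤b decay N = begin
  Σ0to N b              ≤⟨ subst (_≤ Σ0to N b + T (suc N)) (+-identityʳ (Σ0to N b))
                                 (+-monoʳ-≤ (Σ0to N b) (T-nonNeg (suc N))) ⟩
  Σ0to N b + T (suc N)  ≤⟨ Σ0to-telescope-≤ b T step N ⟩
  T 0                   ≡⟨ *-identityʳ (ℕ→ℚ 2 * K) ⟩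
  ℕ→ℚ 2 * K             ∎
  where
  open ≤-Reasoning
  T : ℕ → ℚ
  T k = ℕ→ℚ 2 * K * (+ 1 / suc k)
  0≤K : 0ℚ ≤ K
  0≤K = ≤-trans (*-nonNeg (0≤b 0) (ℕ→ℚ-nonNeg 1)) (decay 0)
  T-nonNeg : ∀ k → 0ℚ ≤ T k
  T-nonNeg k = *-nonNeg (*-nonNeg (ℕ→ℚ-nonNeg 2) 0≤K) (1/suc-nonNeg k)
  step : ∀ k → b k + T (suc k) ≤ T k
  step k = b*m³≤K⇒b+2Kq≤2Kp {m = ℕ→ℚ (suc k)} (0≤b k) (ℕ→ℚ-mono-≤ {1} {suc k} (s≤s z≤n)) (decay k)
    (1/suc-inverseˡ k) (subst (λ m → (+ 1 / suc (suc k)) * m ≡ 1ℚ) (ℕ→ℚ-suc (suc k)) (1/suc-inverseˡ (suc k)))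

-- Decomposition of A_g

x+n>0 : ∀ {x} → 1ℚ ≤ x → ∀ n → 0ℚ < x + ℕ→ℚ n
x+n>0 {x} 1≤x n = <-≤-trans (ℕ→ℚ-pos 0) (≤-trans 1≤x (x≤x+n x n))

g-divBy : ∀ n x (1≤x : 1ℚ ≤ x) →
  g (divBy n x 1≤x) {{divBy-nonNeg n x 1≤x}} ≡ ℕ→ℚ 2 * x * recip (x + ℕ→ℚ n) (x+n>0 1≤x n)
g-divBy n x 1≤x = begin
  ℕ→ℚ 2 * (1/ (1ℚ + ℕ→ℚ n * 1/ x)) {{1+n/x≢0}}
    ≡⟨ cong (ℕ→ℚ 2 *_) (*-inverse-unique {x * w} {1ℚ + ℕ→ℚ n * 1/ x} {{1+n/x≢0}} inverse) ⟨
  ℕ→ℚ 2 * (x * w)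
    ≡⟨ *-assoc (ℕ→ℚ 2) x w ⟨
  ℕ→ℚ 2 * x * w ∎
  where
  open ≡-Reasoning
  instance
    x≢0 : NonZero x
    x≢0 = pos⇒nonZero x {{≥1⇒pos x 1≤x}}
  1+n/x≢0 : NonZero (1ℚ + ℕ→ℚ n * 1/ x)
  1+n/x≢0 = pos⇒nonZero (1ℚ + divBy n x 1≤x) {{pos+nonNeg⇒pos 1ℚ (divBy n x 1≤x) {{divBy-nonNeg n x 1≤x}}}}
  w : ℚ
  w = recip (x + ℕ→ℚ n) (x+n>0 1≤x n)
  regroup : ∀ x w n x⁻¹ → x * w * (1ℚ + n * x⁻¹) ≡ w * (x + n * (x⁻¹ * x))
  regroup = solve-∀ ℚ-ring
  inverse : x * w * (1ℚ + ℕ→ℚ n * 1/ x) ≡ 1ℚ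
  inverse = begin
    x * w * (1ℚ + ℕ→ℚ n * 1/ x)    ≡⟨ regroup x w (ℕ→ℚ n) (1/ x) ⟩
    w * (x + ℕ→ℚ n * (1/ x * x))   ≡⟨ cong (λ z → w * (x + ℕ→ℚ n * z)) (*-inverseˡ x) ⟩
    w * (x + ℕ→ℚ n * 1ℚ)           ≡⟨ cong (λ z → w * (x + z)) (*-identityʳ (ℕ→ℚ n)) ⟩
    w * (x + ℕ→ℚ n)                ≡⟨ recip-inverseˡ (x + ℕ→ℚ n) (x+n>0 1≤x n) ⟩
    1ℚ                             ∎

partial-fractions : ∀ {U y u v w} → u * U ≡ 1ℚ → v * (U + 1ℚ) ≡ 1ℚ → w * (U + 1ℚ + y) ≡ 1ℚ →
  w ≡ - y * u + (1ℚ + y) * v + y * (1ℚ + y) * (u * v * w)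
partial-fractions {U} {y} {u} {v} {w} uU≡1 vU′≡1 wU″≡1 = begin
  w
    ≡⟨ *-identityʳ-twice w ⟨
  w * 1ℚ * 1ℚ
    ≡⟨ cong₂ (λ a b → w * a * b) uU≡1 vU′≡1 ⟨
  w * (u * U) * (v * (U + 1ℚ))
    ≡⟨ clear-denominators U y u v w ⟩
  - y * u * (v * (U + 1ℚ)) * (w * (U + 1ℚ + y)) + (1ℚ + y) * v * (u * U) * (w * (U + 1ℚ + y)) + t
    ≡⟨ cong₂ (λ b c → - y * u * b * c + (1ℚ + y) * v * (u * U) * c + t) vU′≡1 wU″≡1 ⟩
  - y * u * 1ℚ * 1ℚ + (1ℚ + y) * v * (u * U) * 1ℚ + t
    ≡⟨ cong (λ a → - y * u * 1ℚ * 1ℚ + (1ℚ + y) * v * a * 1ℚ + t) uU≡1 ⟩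
  - y * u * 1ℚ * 1ℚ + (1ℚ + y) * v * 1ℚ * 1ℚ + t
    ≡⟨ drop-ones y u v t ⟩
  - y * u + (1ℚ + y) * v + t ∎
  where
  open ≡-Reasoning
  t : ℚ
  t = y * (1ℚ + y) * (u * v * w)
  *-identityʳ-twice : ∀ w → w * 1ℚ * 1ℚ ≡ w
  *-identityʳ-twice = solve-∀ ℚ-ring
  clear-denominators : ∀ U y u v w → w * (u * U) * (v * (U + 1ℚ))
    ≡ - y * u * (v * (U + 1ℚ)) * (w * (U + 1ℚ + y)) + (1ℚ + y) * v * (u * U) * (w * (U + 1ℚ + y))
      + y * (1ℚ + y) * (u * v * w)
  clear-denominators = solve-∀ ℚ-ring
  drop-ones : ∀ y u v t → - y * u * 1ℚ * 1ℚ + (1ℚ + y) * v * 1ℚ * 1ℚ + t ≡ - y * u + (1ℚ + y) * v + t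
  drop-ones = solve-∀ ℚ-ring

Recurrence : (ℕ → ℚ) → Set
Recurrence c = ∀ N → 1 ℕ.≤ N → Σ0to N (λ k → c k * (+ 1 / suc (N ℕ.+ k))) ≡ 0ℚ

module Decomposition (c : ℕ → ℚ) {x : ℚ} (1≤x : 1ℚ ≤ x) (N : ℕ) where

  M : ℕ
  M = suc N

  y : ℚ
  y = x - ℕ→ℚ M

  -- Sums run over k = n - 1, so u k, v k, w k are 1/(N+n), 1/(M+n), 1/(x+n).
  u v w : ℕ → ℚ
  u k = + 1 / suc (N ℕ.+ k)
  v k = + 1 / suc (M ℕ.+ k)
  w k = recip (x + ℕ→ℚ (suc k)) (x+n>0 1≤x (suc k))

  cu cv cuvw : ℕ → ℚ
  cu k = c k * u k
  cv k = c k * v k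
  cuvw k = c k * (u k * v k * w k)

  S₁ S₂ : ℚ
  S₁ = - cv M
  S₂ = Σ0to N cuvw

  term-decomposition : ∀ k → c k * g (divBy (suc k) x 1≤x) {{divBy-nonNeg (suc k) x 1≤x}}
                           ≡ ℕ→ℚ 2 * x * (- y * cu k + (1ℚ + y) * cv k + y * (1ℚ + y) * cuvw k)
  term-decomposition k = begin
    c k * g (divBy (suc k) x 1≤x) {{divBy-nonNeg (suc k) x 1≤x}}
      ≡⟨ cong (c k *_) (g-divBy (suc k) x 1≤x) ⟩
    c k * (ℕ→ℚ 2 * x * w k)
      ≡⟨ cong (λ z → c k * (ℕ→ℚ 2 * x * z)) (partial-fractions {U} {y} {u k} {v k} {w k} uU≡1 vU′≡1 wU″≡1) ⟩
    c k * (ℕ→ℚ 2 * x * (- y * u k + (1ℚ + y) * v k + y * (1ℚ + y) * (u k * v k * w k)))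
      ≡⟨ distribute (c k) (ℕ→ℚ 2 * x) y (u k) (v k) (w k) ⟩
    ℕ→ℚ 2 * x * (- y * cu k + (1ℚ + y) * cv k + y * (1ℚ + y) * cuvw k) ∎
    where
    open ≡-Reasoning
    U : ℚ
    U = ℕ→ℚ (suc (N ℕ.+ k))
    cancel : ∀ m n x → m + n + 1ℚ + (x - m) ≡ x + (n + 1ℚ)
    cancel = solve-∀ ℚ-ring
    U+1+y≡x+[k+1] : U + 1ℚ + y ≡ x + ℕ→ℚ (suc k)
    U+1+y≡x+[k+1] = begin
      U + 1ℚ + y                            ≡⟨ cong (λ z → z + 1ℚ + y) (ℕ→ℚ-+ M k) ⟩
      ℕ→ℚ M + ℕ→ℚ k + 1ℚ + (x - ℕ→ℚ M)    ≡⟨ cancel (ℕ→ℚ M) (ℕ→ℚ k) x ⟩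
      x + (ℕ→ℚ k + 1ℚ)                      ≡⟨ cong (λ z → x + z) (ℕ→ℚ-suc k) ⟨
      x + ℕ→ℚ (suc k)                       ∎
    uU≡1 : u k * U ≡ 1ℚ
    uU≡1 = 1/suc-inverseˡ (N ℕ.+ k)
    vU′≡1 : v k * (U + 1ℚ) ≡ 1ℚ
    vU′≡1 = subst (λ z → v k * z ≡ 1ℚ) (ℕ→ℚ-suc (suc (N ℕ.+ k))) (1/suc-inverseˡ (M ℕ.+ k))
    wU″≡1 : w k * (U + 1ℚ + y) ≡ 1ℚ
    wU″≡1 = subst (λ z → w k * z ≡ 1ℚ) (sym U+1+y≡x+[k+1]) (recip-inverseˡ _ (x+n>0 1≤x (suc k)))
    distribute : ∀ c t y u v w → c * (t * (- y * u + (1ℚ + y) * v + y * (1ℚ + y) * (u * v * w)))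
                               ≡ t * (- y * (c * u) + (1ℚ + y) * (c * v) + y * (1ℚ + y) * (c * (u * v * w)))
    distribute = solve-∀ ℚ-ring

  A-g-decomposition : Recurrence c → 1 ℕ.≤ N →
    Σ0to N (λ k → c k * g (divBy (suc k) x 1≤x) {{divBy-nonNeg (suc k) x 1≤x}})
      ≡ ℕ→ℚ 2 * x * (1ℚ + y) * (S₁ + y * S₂)
  A-g-decomposition rec 1≤N = begin
    Σ0to N (λ k → c k * g (divBy (suc k) x 1≤x) {{divBy-nonNeg (suc k) x 1≤x}})
      ≡⟨ Σ0to-cong N term-decomposition ⟩
    Σ0to N (λ k → ℕ→ℚ 2 * x * (- y * cu k + (1ℚ + y) * cv k + y * (1ℚ + y) * cuvw k))
      ≡⟨ *-distribˡ-Σ0to N (ℕ→ℚ 2 * x) _ ⟨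
    ℕ→ℚ 2 * x * Σ0to N (λ k → - y * cu k + (1ℚ + y) * cv k + y * (1ℚ + y) * cuvw k)
      ≡⟨ cong (ℕ→ℚ 2 * x *_) (Σ0to-linear₃ N (- y) (1ℚ + y) (y * (1ℚ + y)) cu cv cuvw) ⟩
    ℕ→ℚ 2 * x * (- y * Σ0to N cu + (1ℚ + y) * Σ0to N cv + y * (1ℚ + y) * S₂)
      ≡⟨ cong₂ (λ a b → ℕ→ℚ 2 * x * (- y * a + (1ℚ + y) * b + y * (1ℚ + y) * S₂)) (rec N 1≤N) Σcv≡S₁ ⟩
    ℕ→ℚ 2 * x * (- y * 0ℚ + (1ℚ + y) * S₁ + y * (1ℚ + y) * S₂)
      ≡⟨ factor (ℕ→ℚ 2 * x) y S₁ S₂ ⟩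
    ℕ→ℚ 2 * x * (1ℚ + y) * (S₁ + y * S₂) ∎
    where
    open ≡-Reasoning
    Σcv≡S₁ : Σ0to N cv ≡ S₁
    Σcv≡S₁ = inverseˡ-unique (Σ0to N cv) (cv M) (rec M (s≤s z≤n))
    factor : ∀ t y S₁ S₂ → t * (- y * 0ℚ + (1ℚ + y) * S₁ + y * (1ℚ + y) * S₂)
                         ≡ t * (1ℚ + y) * (S₁ + y * S₂)
    factor = solve-∀ ℚ-ring

  module Bounds {K : ℚ} (decay : InverseCubeBound (λ k → c k * c k) K)
                (M≤x : ℕ→ℚ M ≤ x) (x≤M+1 : x ≤ ℕ→ℚ (suc M)) where

    0≤x : 0ℚ ≤ x
    0≤x = ≤-trans (ℕ→ℚ-nonNeg 1) 1≤x

    0≤K : 0ℚ ≤ K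
    0≤K = ≤-trans (*-nonNeg (square-nonNeg (c 0)) (ℕ→ℚ-nonNeg 1)) (decay 0)

    0≤y : 0ℚ ≤ y
    0≤y = p≤q⇒0≤q-p M≤x

    y≤1 : y ≤ 1ℚ
    y≤1 = subst (y ≤_) (cancel (ℕ→ℚ M)) (+-monoˡ-≤ (- ℕ→ℚ M) (subst (x ≤_) (ℕ→ℚ-suc M) x≤M+1))
      where
      cancel : ∀ m → m + 1ℚ - m ≡ 1ℚ
      cancel = solve-∀ ℚ-ring

    xu xv xw E : ℕ → ℚ
    xu k = x * u k
    xv k = x * v k
    xw k = x * w k
    E k = xu k * xv k * xw k

    0≤xu : ∀ k → 0ℚ ≤ xu k
    0≤xu k = *-nonNeg 0≤x (1/suc-nonNeg (N ℕ.+ k))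

    0≤xv : ∀ k → 0ℚ ≤ xv k
    0≤xv k = *-nonNeg 0≤x (1/suc-nonNeg (M ℕ.+ k))

    0≤xw : ∀ k → 0ℚ ≤ xw k
    0≤xw k = *-nonNeg 0≤x (recip-nonNeg _ (x+n>0 1≤x (suc k)))

    0≤E : ∀ k → 0ℚ ≤ E k
    0≤E k = *-nonNeg (*-nonNeg (0≤xu k) (0≤xv k)) (0≤xw k)

    x³S₁-bound : (x * x * x * S₁) * (x * x * x * S₁) ≤ x * K
    x³S₁-bound = begin
      (x * x * x * S₁) * (x * x * x * S₁)             ≡⟨ regroup x (c M) (v M) ⟩
      x * (c M * c M * (x * x * x)) * (xv M * xv M)   ≤⟨ *-mono-≤-nonNeg 0≤xc²x³ (square-nonNeg (xv M))
                                                           (*-monoˡ-≤-nonNeg x {{nonNegative 0≤x}} c²x³≤K)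
                                                           (square-mono-≤ (0≤xv M) xvM≤1) ⟩
      x * K * 1ℚ                                      ≡⟨ *-identityʳ (x * K) ⟩
      x * K                                           ∎
      where
      open ≤-Reasoning
      regroup : ∀ x c v → (x * x * x * - (c * v)) * (x * x * x * - (c * v))
                        ≡ x * (c * c * (x * x * x)) * ((x * v) * (x * v))
      regroup = solve-∀ ℚ-ring
      0≤xc²x³ : 0ℚ ≤ x * (c M * c M * (x * x * x))
      0≤xc²x³ = *-nonNeg 0≤x (*-nonNeg (square-nonNeg (c M)) (*-nonNeg (*-nonNeg 0≤x 0≤x) 0≤x))
      c²x³≤K : c M * c M * (x * x * x) ≤ K
      c²x³≤K = ≤-trans (*-monoˡ-≤-nonNeg (c M * c M) {{nonNegative (square-nonNeg (c M))}} (cube-mono-≤ 0≤x x≤M+1))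
                       (decay M)
      xvM≤1 : xv M ≤ 1ℚ
      xvM≤1 = p≤q⇒pr≤1 (1/suc-nonNeg (M ℕ.+ M)) (1/suc-inverseˡ (M ℕ.+ M))
                       (≤-trans x≤M+1 (ℕ→ℚ-mono-≤ (s≤s (ℕₚ.m≤m+n M M))))

    E≤2 : ∀ k → E k ≤ ℕ→ℚ 2
    E≤2 k = *-mono-≤-nonNeg (*-nonNeg (0≤xu k) (0≤xv k)) (0≤xw k)
                            (*-mono-≤-nonNeg (0≤xu k) (0≤xv k) xu≤2 xv≤1) xw≤1
      where
      double : ∀ p → p + p ≡ ℕ→ℚ 2 * p
      double = solve-∀ ℚ-ring
      j : ℕ
      j = suc (N ℕ.+ k)
      x≤2j : x ≤ ℕ→ℚ 2 * ℕ→ℚ j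
      x≤2j = ≤-trans x≤M+1 (≤-trans
        (ℕ→ℚ-mono-≤ (s≤s (ℕₚ.≤-trans (s≤s (ℕₚ.m≤m+n N k)) (ℕₚ.m≤n+m j (N ℕ.+ k)))))
        (≤-reflexive (trans (ℕ→ℚ-+ j j) (double (ℕ→ℚ j)))))
      xu≤2 : xu k ≤ ℕ→ℚ 2
      xu≤2 = p≤aq⇒pr≤a (1/suc-nonNeg (N ℕ.+ k)) (1/suc-inverseˡ (N ℕ.+ k)) x≤2j
      xv≤1 : xv k ≤ 1ℚ
      xv≤1 = p≤q⇒pr≤1 (1/suc-nonNeg (M ℕ.+ k)) (1/suc-inverseˡ (M ℕ.+ k))
                      (≤-trans x≤M+1 (ℕ→ℚ-mono-≤ (s≤s (ℕₚ.m≤m+n M k))))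
      xw≤1 : xw k ≤ 1ℚ
      xw≤1 = p≤q⇒pr≤1 (recip-nonNeg _ (x+n>0 1≤x (suc k))) (recip-inverseˡ _ (x+n>0 1≤x (suc k)))
                      (x≤x+n x (suc k))

    x³S₂-bound : (x * x * x * S₂) * (x * x * x * S₂) ≤ x * (ℕ→ℚ 2 * (K * ℕ→ℚ 4))
    x³S₂-bound = begin
      (x * x * x * S₂) * (x * x * x * S₂)
        ≡⟨ cong₂ _*_ x³S₂≡Σt x³S₂≡Σt ⟩
      Σ0to N t * Σ0to N t
        ≤⟨ Σ0to-cauchy-schwarz N t ⟩
      ℕ→ℚ M * Σ0to N (λ k → t k * t k)
        ≤⟨ *-monoˡ-≤-nonNeg (ℕ→ℚ M) {{nonNegative (ℕ→ℚ-nonNeg M)}}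
             (Σ0to-inverse-cube-≤ (λ k → t k * t k) (λ k → square-nonNeg (t k)) t²-decay N) ⟩
      ℕ→ℚ M * (ℕ→ℚ 2 * (K * ℕ→ℚ 4))
        ≤⟨ *-monoʳ-≤-nonNeg (ℕ→ℚ 2 * (K * ℕ→ℚ 4)) {{nonNegative 0≤2[4K]}} M≤x ⟩
      x * (ℕ→ℚ 2 * (K * ℕ→ℚ 4)) ∎
      where
      open ≤-Reasoning
      t : ℕ → ℚ
      t k = c k * E k
      0≤2[4K] : 0ℚ ≤ ℕ→ℚ 2 * (K * ℕ→ℚ 4)
      0≤2[4K] = *-nonNeg (ℕ→ℚ-nonNeg 2) (*-nonNeg 0≤K (ℕ→ℚ-nonNeg 4))
      regroup : ∀ x c u v w → x * x * x * (c * (u * v * w)) ≡ c * ((x * u) * (x * v) * (x * w))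
      regroup = solve-∀ ℚ-ring
      x³S₂≡Σt : x * x * x * S₂ ≡ Σ0to N t
      x³S₂≡Σt = trans (*-distribˡ-Σ0to N (x * x * x) cuvw) (Σ0to-cong N (λ k → regroup x (c k) (u k) (v k) (w k)))
      t²-decay : InverseCubeBound (λ k → t k * t k) (K * ℕ→ℚ 4)
      t²-decay k = begin
        t k * t k * m³                 ≡⟨ regroup′ (c k) (E k) m³ ⟩
        c k * c k * m³ * (E k * E k)   ≤⟨ *-mono-≤-nonNeg (*-nonNeg (square-nonNeg (c k)) 0≤m³) (square-nonNeg (E k))
                                                          (decay k) (square-mono-≤ (0≤E k) (E≤2 k)) ⟩
        K * ℕ→ℚ 4                      ∎
        where
        m³ : ℚ
        m³ = ℕ→ℚ (suc k) * ℕ→ℚ (suc k) * ℕ→ℚ (suc k)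
        0≤m³ : 0ℚ ≤ m³
        0≤m³ = *-nonNeg (square-nonNeg (ℕ→ℚ (suc k))) (ℕ→ℚ-nonNeg (suc k))
        regroup′ : ∀ c E m → c * E * (c * E) * m ≡ c * c * m * (E * E)
        regroup′ = solve-∀ ℚ-ring

    decomposed-A-g-bound :
      (ℕ→ℚ 2 * x * (1ℚ + y) * (S₁ + y * S₂)) * (ℕ→ℚ 2 * x * (1ℚ + y) * (S₁ + y * S₂)) * (x * x * x)
        ≤ ℕ→ℚ 288 * K
    decomposed-A-g-bound = *-cancelˡ-≤-pos x {{positive (<-≤-trans (ℕ→ℚ-pos 0) 1≤x)}} (begin
      x * ((ℕ→ℚ 2 * x * (1ℚ + y) * (S₁ + y * S₂)) * (ℕ→ℚ 2 * x * (1ℚ + y) * (S₁ + y * S₂)) * (x * x * x))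
        ≡⟨ regroup x y S₁ S₂ ⟩
      (ℕ→ℚ 2 * (1ℚ + y)) * (ℕ→ℚ 2 * (1ℚ + y)) * ((P + y * R) * (P + y * R))
        ≤⟨ *-mono-≤-nonNeg (square-nonNeg (ℕ→ℚ 2 * (1ℚ + y))) (square-nonNeg (P + y * R))
                           (square-mono-≤ 0≤2[1+y] 2[1+y]≤4) [P+yR]²-bound ⟩
      ℕ→ℚ 4 * ℕ→ℚ 4 * (ℕ→ℚ 2 * (x * K) + ℕ→ℚ 2 * (x * (ℕ→ℚ 2 * (K * ℕ→ℚ 4))))
        ≡⟨ collect x K ⟩
      x * (ℕ→ℚ 288 * K) ∎)
      where
      open ≤-Reasoning
      P R : ℚ
      P = x * x * x * S₁
      R = x * x * x * S₂
      regroup : ∀ x y S₁ S₂ →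
        x * ((ℕ→ℚ 2 * x * (1ℚ + y) * (S₁ + y * S₂)) * (ℕ→ℚ 2 * x * (1ℚ + y) * (S₁ + y * S₂)) * (x * x * x))
        ≡ (ℕ→ℚ 2 * (1ℚ + y)) * (ℕ→ℚ 2 * (1ℚ + y))
          * ((x * x * x * S₁ + y * (x * x * x * S₂)) * (x * x * x * S₁ + y * (x * x * x * S₂)))
      regroup = solve-∀ ℚ-ring
      collect : ∀ x K → ℕ→ℚ 4 * ℕ→ℚ 4 * (ℕ→ℚ 2 * (x * K) + ℕ→ℚ 2 * (x * (ℕ→ℚ 2 * (K * ℕ→ℚ 4))))
                        ≡ x * (ℕ→ℚ 288 * K)
      collect = solve-∀ ℚ-ring
      0≤2[1+y] : 0ℚ ≤ ℕ→ℚ 2 * (1ℚ + y)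
      0≤2[1+y] = *-nonNeg (ℕ→ℚ-nonNeg 2) (+-mono-≤ (ℕ→ℚ-nonNeg 1) 0≤y)
      2[1+y]≤4 : ℕ→ℚ 2 * (1ℚ + y) ≤ ℕ→ℚ 4
      2[1+y]≤4 = *-monoˡ-≤-nonNeg (ℕ→ℚ 2) (+-monoʳ-≤ 1ℚ y≤1)
      [yR]²≤R² : (y * R) * (y * R) ≤ R * R
      [yR]²≤R² = begin
        (y * R) * (y * R)    ≡⟨ regroup′ y R ⟩
        (y * y) * (R * R)    ≤⟨ *-monoʳ-≤-nonNeg (R * R) {{nonNegative (square-nonNeg R)}} (square-mono-≤ 0≤y y≤1) ⟩
        1ℚ * (R * R)         ≡⟨ *-identityˡ (R * R) ⟩
        R * R                ∎
        where
        regroup′ : ∀ y R → (y * R) * (y * R) ≡ (y * y) * (R * R)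
        regroup′ = solve-∀ ℚ-ring
      [P+yR]²-bound : (P + y * R) * (P + y * R) ≤ ℕ→ℚ 2 * (x * K) + ℕ→ℚ 2 * (x * (ℕ→ℚ 2 * (K * ℕ→ℚ 4)))
      [P+yR]²-bound = ≤-trans ([p+q]²≤2p²+2q² P (y * R))
        (+-mono-≤ (*-monoˡ-≤-nonNeg (ℕ→ℚ 2) x³S₁-bound)
                  (*-monoˡ-≤-nonNeg (ℕ→ℚ 2) (≤-trans [yR]²≤R² x³S₂-bound)))

A-g-bound : ∀ c → Recurrence c → ∀ {K} → InverseCubeBound (λ k → c k * c k) K →
  ∀ x (1≤x : 1ℚ ≤ x) → ℕ→ℚ 2 ≤ x →
  A-g (λ n → c (n ∸ 1)) x 1≤x * A-g (λ n → c (n ∸ 1)) x 1≤x * (x * x * x) ≤ ℕ→ℚ 288 * K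
A-g-bound c rec {K} decay x 1≤x 2≤x = at-floor ℤ.∣ floor x ∣ (floor-bounds x (≤-trans (ℕ→ℚ-nonNeg 1) 1≤x))
  where
  a-g : ℕ → ℚ
  a-g n = c (n ∸ 1) * g (divBy n x 1≤x) {{divBy-nonNeg n x 1≤x}}
  at-floor : ∀ M → ℕ→ℚ M ≤ x × x < ℕ→ℚ (suc M) → Σ1to M a-g * Σ1to M a-g * (x * x * x) ≤ ℕ→ℚ 288 * K
  at-floor zero          (_ , x<1) = ⊥-elim (<-irrefl refl (<-≤-trans x<1 1≤x))
  at-floor (suc zero)    (_ , x<2) = ⊥-elim (<-irrefl refl (<-≤-trans x<2 2≤x))
  at-floor (suc (suc m)) (M≤x , x<M+1) =
    subst (λ A → A * A * (x * x * x) ≤ ℕ→ℚ 288 * K)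
          (sym (trans (Σ1to-suc N a-g) (A-g-decomposition rec (s≤s z≤n))))
          (Bounds.decomposed-A-g-bound decay M≤x (<⇒≤ x<M+1))
    where
    N : ℕ
    N = suc m
    open Decomposition c 1≤x N

lemma4p2 : (c : ℕ → ℚ)
    → c 0 ≡ 1ℚ
    → (∀ N → 1 ℕ.≤ N → Σ0to N (λ k → c k * (+ 1 / suc (N ℕ.+ k))) ≡ 0ℚ)
    → (∃ λ C → ∃ λ n₀ → ∀ n → n₀ ℕ.≤ n → 1 ℕ.≤ n
         → ∣ c (n ∸ 1) ∣ * ∣ c (n ∸ 1) ∣ * (ℕ→ℚ n * ℕ→ℚ n * ℕ→ℚ n) ≤ C)
    → ∃ λ C → ∃ λ X → ∀ x → (1≤x : 1ℚ ≤ x) → X ≤ x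
         → A-g (λ n → c (n ∸ 1)) x 1≤x * A-g (λ n → c (n ∸ 1)) x 1≤x * (x * x * x) ≤ C
lemma4p2 c _ rec (C , n₀ , eventually) = ℕ→ℚ 288 * K , ℕ→ℚ 2 , A-g-bound c rec decay
  where
  P : ℕ → ℚ
  P n = ∣ c (n ∸ 1) ∣ * ∣ c (n ∸ 1) ∣ * (ℕ→ℚ n * ℕ→ℚ n * ℕ→ℚ n)
  bounded : ∃ λ K → ∀ n → P n ≤ K
  bounded = eventually-bounded⇒bounded P (suc n₀)
    (λ n n₀<n → eventually n (ℕₚ.<⇒≤ n₀<n) (ℕₚ.≤-trans (s≤s z≤n) n₀<n))
  K : ℚ
  K = proj₁ bounded
  decay : InverseCubeBound (λ k → c k * c k) K
  decay k = subst (λ s → s * (ℕ→ℚ (suc k) * ℕ→ℚ (suc k) * ℕ→ℚ (suc k)) ≤ K) (∣p∣*∣p∣≡p*p (c k))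
                  (proj₂ bounded (suc k))
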